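{- Let $D$ be an $r$-regular digraph with $r\geq 2$ and at least $8r^4$ vertices. Then $dib(D)=r+1$.
   Context: All digraphs are finite, loopless, and simple: $D=(V,A)$ where $A$ is a set of ordered pairs $uv$ (darts) of distinct vertices; both $uv$ and $vu$ may be darts. $D$ is $r$-regular if every vertex has exactly $r$ out-going darts and exactly $r$ in-coming darts. A coloring of $D$ with $k$ colors is a surjective map $\varsigma:V\to\{1,\dots,k\}$; it is acyclic if each color class induces a subdigraph with no directed cycle. With respect to $\varsigma$, a vertex $u$ is a $b^+$-vertex if for every color $j\neq\varsigma(u)$ there is a dart $uw$ with $\varsigma(w)=j$, and a $b^-$-vertex if for every color $j\neq \varsigma(u)$ there is a dart $wu$ with $\varsigma(w)=j$. A $b$-coloring is a coloring in which every color class contains a $b^+$-vertex and a $b^-$-vertex. The dib-chromatic number $dib(D)$ is the largest $k$ such that $D$ admits an acyclic $b$-coloring with $k$ colors. -}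

module Defs where

open import Data.Nat using (ℕ; zero; suc; _≤_; _+_; _*_; _^_)
open import Data.Bool using (Bool; true; false; T)
open import Data.Fin using (Fin; zero; suc; inject₁; fromℕ)
open import Data.List using (length; filterᵇ; allFin)
open import Data.Product using (Σ; ∃; _×_; _,_)
open import Relation.Binary.PropositionalEquality using (_≡_)
open import Relation.Nullary using (¬_)
open import Function.Definitions using (Injective)
open import Function.Bundles using (Surjection)

-- A digraph on the vertex set Fin n, given by its (Boolean) dart relation.
-- Simplicity is automatic (a relation); looplessness is a field.
record Digraph (n : ℕ) : Set where
  field
    dart     : Fin n → Fin n → Bool
    loopless : ∀ v → dart v v ≡ false

open Digraph public

Dart : ∀ {n} → Digraph n → Fin n → Fin n → Set
Dart D u w = T (dart D u w)

outdeg : ∀ {n} → Digraph n → Fin n → ℕ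
outdeg {n} D v = length (filterᵇ (λ w → dart D v w) (allFin n))

indeg : ∀ {n} → Digraph n → Fin n → ℕ
indeg {n} D v = length (filterᵇ (λ w → dart D w v) (allFin n))

Regular : ∀ {n} → ℕ → Digraph n → Set
Regular r D = ∀ v → outdeg D v ≡ r × indeg D v ≡ r

-- A directed cycle of length m+1 (m ≥ 1): distinct vertices c 0, …, c m with
-- darts c i → c (i+1) and c m → c 0.
record DirCycle {n} (D : Digraph n) : Set where
  field
    m      : ℕ
    m≥1    : 1 ≤ m
    vtx    : Fin (suc m) → Fin n
    inj    : Injective _≡_ _≡_ vtx
    step   : ∀ (i : Fin m) → Dart D (vtx (inject₁ i)) (vtx (suc i))
    close  : Dart D (vtx (fromℕ m)) (vtx zero)

open DirCycle public

record Coloring {n} (k : ℕ) : Set where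
  field
    col  : Fin n → Fin k
    surj : ∀ (j : Fin k) → ∃ λ v → col v ≡ j

open Coloring public

Acyclic : ∀ {n k} → Digraph n → Coloring {n} k → Set
Acyclic D ς = (C : DirCycle D) → ¬ (∀ i j → col ς (vtx C i) ≡ col ς (vtx C j))

IsBPlus : ∀ {n k} → Digraph n → Coloring {n} k → Fin n → Set
IsBPlus {k = k} D ς u =
  ∀ (j : Fin k) → ¬ (j ≡ col ς u) → ∃ λ w → Dart D u w × col ς w ≡ j

IsBMinus : ∀ {n k} → Digraph n → Coloring {n} k → Fin n → Set
IsBMinus {k = k} D ς u =
  ∀ (j : Fin k) → ¬ (j ≡ col ς u) → ∃ λ w → Dart D w u × col ς w ≡ j

IsBColoring : ∀ {n k} → Digraph n → Coloring {n} k → Set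
IsBColoring {k = k} D ς =
  ∀ (i : Fin k) → (∃ λ u → col ς u ≡ i × IsBPlus D ς u)
                × (∃ λ u → col ς u ≡ i × IsBMinus D ς u)

HasAcyclicB : ∀ {n} → Digraph n → ℕ → Set
HasAcyclicB {n} D k = Σ (Coloring {n} k) λ ς → Acyclic D ς × IsBColoring D ς

DibEq : ∀ {n} → Digraph n → ℕ → Set
DibEq D d = HasAcyclicB D d × (∀ k → HasAcyclicB D k → k ≤ d)

{-# OPTIONS --safe #-}
-- Upper bound: a b⁺-vertex sees all k − 1 other colours among its r out-neighbours.
--
-- Lower bound: for each colour i take an in-star and an out-star, i.e. a centre
-- together with its r in- resp. out-neighbours. The centre gets colour i and its
-- leaves get the r other colours bijectively, so the centre is a b⁻- resp.
-- b⁺-vertex. Every other vertex is coloured greedily, in index order, with a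
-- colour missing among its out-neighbours. The 2r + 2 centres are chosen one by
-- one, each avoiding the at most r³ + 3r² + 2r + 1 vertices that are near an
-- earlier star; n ≥ 8r⁴ > (2r + 1)(r³ + 3r² + 2r + 1) leaves room for this.
-- Being far apart makes the stars disjoint and makes every monochromatic dart go
-- up in the order: centres, then leaves (both by the order in which the stars were
-- chosen), then the greedily coloured vertices in index order. A rank that increases along
-- monochromatic darts rules out monochromatic cycles.

module Submission where

open import Defs
open import Data.Nat using (ℕ; _≤_; _*_; _^_; _+_)

open import Data.Nat using (zero; suc; _<_; z≤n; s≤s; s≤s⁻¹; _<?_)
open import Data.Nat.Properties
  using ( ≤-refl; ≤-reflexive; ≤-trans; <-trans; <-irrefl; <-cmp; <⇒≤; <⇒≱
        ; <-≤-trans; ≤-<-trans; ≤∧≢⇒<; m≤n⇒m<n∨m≡n; n≤1+n; m≤m+n; m≤n+m; m<m+n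
        ; m+n≮m; m+n≮n; +-comm; +-suc; +-cancelˡ-≡; +-mono-≤; +-monoʳ-≤; +-monoʳ-<
        ; *-monoˡ-≤; module ≤-Reasoning )
open import Data.Nat.Tactic.RingSolver using (solve-∀)
open import Data.Bool using (Bool; true; false; T; _∨_; if_then_else_)
open import Data.Bool.Properties using (T-∨)
open import Data.Bool.ListAction using (any)
open import Data.Fin using (Fin; zero; suc; toℕ; fromℕ<; inject₁; fromℕ; punchIn; punchOut; _≟_)
open import Data.Fin.Properties
  using ( injective⇒≤; all?; any?; ¬∀⟶∃¬; toℕ<n; toℕ≤pred[n]; toℕ-injective; toℕ-fromℕ<
        ; punchIn-injective; punchInᵢ≢i; punchOut-injective )
open import Data.List using (List; []; _∷_; length; filterᵇ; allFin; lookup; upTo)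
open import Data.List.Properties using (filter-all; filter-none; length-tabulate; length-upTo)
open import Data.List.Membership.Propositional using (_∈_; lose)
open import Data.List.Membership.Propositional.Properties
  using (∈-filter⁺; ∈-filter⁻; ∈-allFin; ∈-lookup; ∈-upTo⁺)
open import Data.List.Relation.Unary.All as All using (All)
open import Data.List.Relation.Unary.All.Properties using (¬All⇒Any¬)
open import Data.List.Relation.Unary.Any using (index; satisfied)
open import Data.List.Relation.Unary.Any.Properties using (lookup-index; any⁺)
open import Data.List.Relation.Unary.AllPairs using (_∷_)
open import Data.List.Relation.Unary.Unique.Propositional using (Unique)
import Data.List.Relation.Unary.Unique.Propositional.Properties as Unique
open import Data.Product using (Σ; ∃; ∃₂; _×_; _,_; proj₁; proj₂)
open import Data.Sum as Sum using (_⊎_; inj₁; inj₂)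
open import Data.Vec.Functional using (updateAt)
open import Data.Vec.Functional.Properties using (updateAt-updates; updateAt-minimal)
open import Function using (_∘_; id)
open import Function.Bundles using (Equivalence)
open import Function.Definitions using (Injective)
open import Relation.Binary using (tri<; tri≈; tri>)
open import Relation.Binary.PropositionalEquality
  using (_≡_; _≢_; refl; sym; trans; cong; subst; subst₂; ≢-sym; module ≡-Reasoning)
open import Relation.Nullary using (¬_; Dec; yes; no; contradiction)
open import Relation.Nullary.Decidable using (T?; _×-dec_; ⌊_⌋; toWitness; fromWitness)

private
  variable
    A B : Set
    n k : ℕ

T-∨ˡ : ∀ {a b} → T a → T (a ∨ b)
T-∨ˡ = Equivalence.from T-∨ ∘ inj₁

T-∨ʳ : ∀ {a b} → T b → T (a ∨ b)
T-∨ʳ = Equivalence.from T-∨ ∘ inj₂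

T-any : ∀ (p : A → Bool) {x xs} → x ∈ xs → T (p x) → T (any p xs)
T-any p x∈xs px = any⁺ p (lose x∈xs px)

module _ (p q : A → Bool) where

  length-filterᵇ-∨ : ∀ xs → length (filterᵇ (λ x → p x ∨ q x) xs)
                            ≤ length (filterᵇ p xs) + length (filterᵇ q xs)
  length-filterᵇ-∨ [] = z≤n
  length-filterᵇ-∨ (x ∷ xs) with ih ← length-filterᵇ-∨ xs | p x | q x
  ... | true  | true  = s≤s (≤-trans ih (+-monoʳ-≤ _ (n≤1+n _)))
  ... | true  | false = s≤s ih
  ... | false | true  = ≤-trans (s≤s ih) (≤-reflexive (sym (+-suc _ _)))
  ... | false | false = ih

length-filterᵇ-any : (P : B → A → Bool) (bs : List B) (xs : List A) →
  (∀ b → length (filterᵇ (P b) xs) ≤ k) →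
  length (filterᵇ (λ x → any (λ b → P b x) bs) xs) ≤ length bs * k
length-filterᵇ-any P [] xs _ =
  ≤-reflexive (cong length (filter-none (T? ∘ λ _ → false) (All.universal (λ _ ()) xs)))
length-filterᵇ-any P (b ∷ bs) xs bound = ≤-trans (length-filterᵇ-∨ (P b) _ xs)
  (+-mono-≤ (bound b) (length-filterᵇ-any P bs xs bound))

lookup-injective : ∀ {xs : List A} → Unique xs → Injective _≡_ _≡_ (lookup xs)
lookup-injective (_  ∷ _) {zero}  {zero}  _ = refl
lookup-injective (x≢ ∷ _) {zero}  {suc j} e = contradiction e (All.lookup x≢ (∈-lookup j))
lookup-injective (x≢ ∷ _) {suc i} {zero}  e = contradiction (sym e) (All.lookup x≢ (∈-lookup i))
lookup-injective (_  ∷ u) {suc i} {suc j} e = cong suc (lookup-injective u e)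

members : (Fin n → Bool) → List (Fin n)
members {n} p = filterᵇ p (allFin n)

count : (Fin n → Bool) → ℕ
count p = length (members p)

∈-members : ∀ (p : Fin n → Bool) {v} → T (p v) → v ∈ members p
∈-members p {v} pv = ∈-filter⁺ (T? ∘ p) (∈-allFin v) pv

lookup-members : ∀ (p : Fin n → Bool) i → T (p (lookup (members p) i))
lookup-members {n} p i = proj₂ (∈-filter⁻ (T? ∘ p) {xs = allFin n} (∈-lookup i))

lookup-members-injective : ∀ (p : Fin n → Bool) → Injective _≡_ _≡_ (lookup (members p))
lookup-members-injective {n} p = lookup-injective (Unique.filter⁺ (T? ∘ p) (Unique.allFin⁺ n))

enumerate : ∀ (p : Fin n → Bool) → count p ≡ k →
  Σ (Fin k → Fin n) λ e → Injective _≡_ _≡_ e × (∀ q → T (p (e q)))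
enumerate p refl = lookup (members p) , lookup-members-injective p , lookup-members p

count-injection : ∀ (p : Fin n → Bool) (g : Fin k → Fin n) → Injective _≡_ _≡_ g →
  (∀ q → T (p (g q))) → k ≤ count p
count-injection {k = k} p g g-injective pg = injective⇒≤ {f = position} position-injective
  where
  position : Fin k → Fin (count p)
  position q = index (∈-members p (pg q))

  position-injective : Injective _≡_ _≡_ position
  position-injective {x} {y} e = g-injective (begin
    g x                              ≡⟨ lookup-index (∈-members p (pg x)) ⟩
    lookup (members p) (position x)  ≡⟨ cong (lookup (members p)) e ⟩
    lookup (members p) (position y)  ≡⟨ lookup-index (∈-members p (pg y)) ⟨
    g y                              ∎)
    where open ≡-Reasoning

count≤1 : ∀ (p : Fin n → Bool) → (∀ {v w} → T (p v) → T (p w) → v ≡ w) → count p ≤ 1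
count≤1 p single = injective⇒≤ {f = λ _ → zero} λ {i} {j} _ →
  lookup-members-injective p (single (lookup-members p i) (lookup-members p j))

count<n⇒∃¬ : ∀ (p : Fin n → Bool) → count p < n → ∃ λ v → ¬ T (p v)
count<n⇒∃¬ {n} p small = satisfied (¬All⇒Any¬ (T? ∘ p) (allFin n) λ all-p →
  <-irrefl (trans (cong length (filter-all (T? ∘ p) all-p)) (length-tabulate id)) small)

Agrees : (Fin n → Bool) → (Fin n → Fin k) → (Fin n → Fin k) → Set
Agrees P f c = ∀ {v} → T (P v) → c v ≡ f v

module _ (D : Digraph n) where

  Dart-irreflexive : ∀ {u w} → Dart D u w → u ≢ w
  Dart-irreflexive {u} d refl = subst T (loopless D u) d

  outdeg-≥-seen : (c : Fin n → A) (e : Fin k → A) → Injective _≡_ _≡_ e →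
    ∀ u → (∀ q → ∃ λ w → Dart D u w × c w ≡ e q) → k ≤ outdeg D u
  outdeg-≥-seen {k = k} c e e-injective u seen =
    count-injection (dart D u) witness witness-injective (proj₁ ∘ proj₂ ∘ seen)
    where
    witness : Fin k → Fin n
    witness = proj₁ ∘ seen

    witness-injective : Injective _≡_ _≡_ witness
    witness-injective {x} {y} eq = e-injective (begin
      e x              ≡⟨ proj₂ (proj₂ (seen x)) ⟨
      c (witness x)    ≡⟨ cong c eq ⟩
      c (witness y)    ≡⟨ proj₂ (proj₂ (seen y)) ⟩
      e y              ∎)
      where open ≡-Reasoning

  b-colouring-bound : ∀ {r} (ς : Coloring {n} k) → IsBColoring D ς →
                      (∀ u → outdeg D u ≤ r) → k ≤ suc r
  b-colouring-bound {zero}  ς _ _ = z≤n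
  b-colouring-bound {suc k} ς b Δ⁺≤r with u , _ , b⁺ ← proj₁ (b zero) =
    s≤s (≤-trans (outdeg-≥-seen (col ς) (punchIn (col ς u)) (punchIn-injective (col ς u) _ _) u
                   λ q → b⁺ (punchIn (col ς u) q) (punchInᵢ≢i _ _))
                 (Δ⁺≤r u))

  seen? : ∀ u (c : Fin n → Fin k) j → Dec (∃ λ w → Dart D u w × c w ≡ j)
  seen? u c j = any? λ w → T? (dart D u w) ×-dec c w ≟ j

  missing-colour : ∀ u → outdeg D u < k → (c : Fin n → Fin k) →
                   ∃ λ j → ∀ {w} → Dart D u w → c w ≢ j
  missing-colour {k} u small c with all? (seen? u c)
  ... | yes seen = contradiction (outdeg-≥-seen c id id u seen) (<⇒≱ small)
  ... | no ¬seen = let j , unseen = ¬∀⟶∃¬ k _ (seen? u c) ¬seen in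
                   j , λ d e → unseen (_ , d , e)

  Ranked : (Fin n → Fin k) → Set
  Ranked c = ∃ λ (rank : Fin n → ℕ) → ∀ {u w} → Dart D u w → c u ≡ c w → rank u < rank w

  increasing⇒head≤ : ∀ {m} (g : Fin (suc m) → ℕ) →
                     (∀ i → g (inject₁ i) < g (suc i)) → ∀ i → g zero ≤ g i
  increasing⇒head≤ g increasing zero = ≤-refl
  increasing⇒head≤ {suc m} g increasing (suc i) =
    ≤-trans (increasing⇒head≤ (g ∘ inject₁) (increasing ∘ inject₁) i) (<⇒≤ (increasing i))

  ranked⇒acyclic : (ς : Coloring {n} k) → Ranked (col ς) → Acyclic D ς
  ranked⇒acyclic ς (rank , increasing) C monochromatic = <-irrefl refl (<-≤-trans
    (increasing (close C) (monochromatic _ _))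
    (increasing⇒head≤ (rank ∘ vtx C) (λ i → increasing (step C i) (monochromatic _ _)) (fromℕ (m C))))

  module _ (sparse : ∀ u → outdeg D u < k) (P : Fin n → Bool) (f : Fin n → Fin k) where

    ForwardBelow : ℕ → (Fin n → Fin k) → Set
    ForwardBelow m c = ∀ {u w} → Dart D u w → ¬ T (P u) → toℕ u < m → c u ≡ c w →
                       ¬ T (P w) × toℕ u < toℕ w

    Partial : ℕ → Set
    Partial m = Σ (Fin n → Fin k) λ c → Agrees P f c × ForwardBelow m c

    private
      <-suc-toℕ : ∀ {u v : Fin n} → toℕ u < suc (toℕ v) → u ≢ v → toℕ u < toℕ v
      <-suc-toℕ u≤v u≢v = ≤∧≢⇒< (s≤s⁻¹ u≤v) (u≢v ∘ toℕ-injective)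

    -- v takes a colour missing among its out-neighbours, so a monochromatic dart
    -- leaving v ends at a vertex that is recoloured later.
    colour-next : ∀ {m} (v : Fin n) → toℕ v ≡ m → Partial m → Partial (suc m)
    colour-next v refl (c , agrees , forward) with T? (P v)
    ... | yes Pv = c , agrees , forward′
      where
      forward′ : ForwardBelow (suc (toℕ v)) c
      forward′ {u} d ¬Pu u≤v e with u ≟ v
      ... | yes refl = contradiction Pv ¬Pu
      ... | no u≢v   = forward d ¬Pu (<-suc-toℕ u≤v u≢v) e
    ... | no ¬Pv with j , avoids-j ← missing-colour v (sparse v) c = c′ , agrees′ , forward′
      where
      c′ : Fin n → Fin k
      c′ = updateAt c v (λ _ → j)

      unchanged : ∀ {u} → u ≢ v → c′ u ≡ c u
      unchanged u≢v = updateAt-minimal _ v c u≢v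

      agrees′ : Agrees P f c′
      agrees′ Pu = trans (unchanged λ { refl → ¬Pv Pu }) (agrees Pu)

      forward′ : ForwardBelow (suc (toℕ v)) c′
      forward′ {u} {w} d ¬Pu u≤v e with u ≟ v | w ≟ v
      ... | yes refl | _ = contradiction
        (trans (sym (unchanged (≢-sym (Dart-irreflexive d)))) (trans (sym e) (updateAt-updates v c)))
        (avoids-j d)
      ... | no u≢v | yes refl = ¬Pv , <-suc-toℕ u≤v u≢v
      ... | no u≢v | no w≢v   = forward d ¬Pu (<-suc-toℕ u≤v u≢v)
        (trans (sym (unchanged u≢v)) (trans e (unchanged w≢v)))

    partial-colouring : ∀ m → m ≤ n → Partial m
    partial-colouring zero    _   = f , (λ _ → refl) , (λ _ _ ())
    partial-colouring (suc m) m<n =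
      colour-next (fromℕ< m<n) (toℕ-fromℕ< m<n) (partial-colouring m (<⇒≤ m<n))

    ranked-extension : (ρ : Fin n → ℕ) (M : ℕ) → (∀ {v} → T (P v) → ρ v < M) →
      (∀ {u w} → Dart D u w → T (P u) → T (P w) → f u ≡ f w → ρ u < ρ w) →
      Σ (Fin n → Fin k) λ c → Agrees P f c × Ranked c
    ranked-extension ρ M ρ<M ρ-increasing = c , agrees , rank , increasing
      where
      c : Fin n → Fin k
      c = proj₁ (partial-colouring n ≤-refl)

      agrees : Agrees P f c
      agrees = proj₁ (proj₂ (partial-colouring n ≤-refl))

      forward : ForwardBelow n c
      forward = proj₂ (proj₂ (partial-colouring n ≤-refl))

      rank : Fin n → ℕ
      rank v = if P v then ρ v else M + toℕ v

      rank-P : ∀ {v} → T (P v) → rank v ≡ ρ v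
      rank-P {v} Pv with P v
      ... | true = refl

      rank-¬P : ∀ {v} → ¬ T (P v) → rank v ≡ M + toℕ v
      rank-¬P {v} ¬Pv with P v
      ... | true  = contradiction _ ¬Pv
      ... | false = refl

      increasing : ∀ {u w} → Dart D u w → c u ≡ c w → rank u < rank w
      increasing {u} {w} d e with T? (P u) | T? (P w)
      ... | yes Pu | yes Pw = subst₂ _<_ (sym (rank-P Pu)) (sym (rank-P Pw))
        (ρ-increasing d Pu Pw (trans (sym (agrees Pu)) (trans e (agrees Pw))))
      ... | yes Pu | no ¬Pw = subst₂ _<_ (sym (rank-P Pu)) (sym (rank-¬P ¬Pw))
        (<-≤-trans (ρ<M Pu) (m≤m+n M (toℕ w)))
      ... | no ¬Pu | _ with ¬Pw , u<w ← forward d ¬Pu (toℕ<n u) e =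
        subst₂ _<_ (sym (rank-¬P ¬Pu)) (sym (rank-¬P ¬Pw)) (+-monoʳ-< M u<w)

module _ (near : ℕ → Fin n → ℕ → Fin n → Bool) {B K : ℕ}
         (count-near : ∀ s c t → count (near s c t) ≤ B) (roomy : K * B < n) where

  SpreadBelow : ℕ → Set
  SpreadBelow t = Σ (ℕ → Fin n) λ x →
    ∀ {s t′} → s < t′ → t′ < t → ¬ T (near s (x s) t′ (x t′))

  spread-next : ∀ t → t ≤ K → SpreadBelow t → SpreadBelow (suc t)
  spread-next t t≤K (x , far) = x′ , far′
    where
    nearSome : Fin n → Bool
    nearSome z = any (λ s → near s (x s) t z) (upTo t)

    few : count nearSome < n
    few = begin-strict
      count nearSome
        ≤⟨ length-filterᵇ-any (λ s → near s (x s) t) (upTo t) (allFin n) (λ s → count-near s (x s) t) ⟩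
      length (upTo t) * B  ≡⟨ cong (_* B) (length-upTo t) ⟩
      t * B                ≤⟨ *-monoˡ-≤ B t≤K ⟩
      K * B                <⟨ roomy ⟩
      n                    ∎
      where open ≤-Reasoning

    z : Fin n
    z = proj₁ (count<n⇒∃¬ nearSome few)

    z-far : ¬ T (nearSome z)
    z-far = proj₂ (count<n⇒∃¬ nearSome few)

    x′ : ℕ → Fin n
    x′ s with s <? t
    ... | yes _ = x s
    ... | no _  = z

    x′-old : ∀ {s} → s < t → x′ s ≡ x s
    x′-old {s} s<t with s <? t
    ... | yes _  = refl
    ... | no s≮t = contradiction s<t s≮t

    x′-new : x′ t ≡ z
    x′-new with t <? t
    ... | yes t<t = contradiction t<t (<-irrefl refl)
    ... | no _    = refl

    far′ : ∀ {s t′} → s < t′ → t′ < suc t → ¬ T (near s (x′ s) t′ (x′ t′))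
    far′ {s} {t′} s<t′ t′≤t with m≤n⇒m<n∨m≡n (s≤s⁻¹ t′≤t)
    ... | inj₁ t′<t rewrite x′-old (<-trans s<t′ t′<t) | x′-old t′<t = far s<t′ t′<t
    ... | inj₂ refl rewrite x′-old s<t′ | x′-new =
      z-far ∘ T-any (λ s → near s (x s) t z) (∈-upTo⁺ s<t′)

  spread : Σ (ℕ → Fin n) λ x → ∀ {s t} → s < t → t ≤ K → ¬ T (near s (x s) t (x t))
  spread = let x , far = spread-upto K ≤-refl in x , λ s<t t≤K → far s<t (s≤s t≤K)
    where
    spread-upto : ∀ t → t ≤ K → SpreadBelow (suc t)
    spread-upto zero    0≤K =
      spread-next 0 0≤K ((λ _ → fromℕ< (≤-<-trans z≤n roomy)) , λ _ ())
    spread-upto (suc t) t<K = spread-next (suc t) t<K (spread-upto t (<⇒≤ t<K))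

data Dir : Set where
  ⊕ ⊖ : Dir

nearBound : ℕ → ℕ
nearBound r = suc r + ((suc r + suc r * r) * r + r * r)

module Stars (D : Digraph n) {r} (reg : Regular r D) where

  leaf : Dir → Fin n → Fin n → Bool
  leaf ⊕ c v = dart D c v
  leaf ⊖ c v = dart D v c

  leaf-irreflexive : ∀ σ {c} → ¬ T (leaf σ c c)
  leaf-irreflexive ⊕ d = Dart-irreflexive D d refl
  leaf-irreflexive ⊖ d = Dart-irreflexive D d refl

  count-leaf : ∀ σ c → count (leaf σ c) ≡ r
  count-leaf ⊕ c = proj₁ (reg c)
  count-leaf ⊖ c = proj₂ (reg c)

  count-centres : ∀ σ v → count (λ c → leaf σ c v) ≡ r
  count-centres ⊕ v = proj₂ (reg v)
  count-centres ⊖ v = proj₁ (reg v)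

  inStar : Dir → Fin n → Fin n → Bool
  inStar σ c v = ⌊ v ≟ c ⌋ ∨ leaf σ c v

  inStar-centre : ∀ σ c → T (inStar σ c c)
  inStar-centre σ c = T-∨ˡ {a = ⌊ c ≟ c ⌋} (fromWitness refl)

  inStar-leaf : ∀ σ {c v} → T (leaf σ c v) → T (inStar σ c v)
  inStar-leaf σ = T-∨ʳ

  inStar⁻ : ∀ σ {c v} → T (inStar σ c v) → v ≡ c ⊎ T (leaf σ c v)
  inStar⁻ σ = Sum.map₁ toWitness ∘ Equivalence.to T-∨

  count-inStar : ∀ σ c → count (inStar σ c) ≤ suc r
  count-inStar σ c = ≤-trans (length-filterᵇ-∨ _ _ (allFin n)) (+-mono-≤
    (count≤1 (λ v → ⌊ v ≟ c ⌋) λ v≡c w≡c → trans (toWitness v≡c) (sym (toWitness w≡c)))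
    (≤-reflexive (count-leaf σ c)))

  entersStar : Dir → Fin n → Fin n → Bool
  entersStar σ c u = inStar σ c u ∨ any (dart D u) (members (inStar σ c))

  count-entersStar : ∀ σ c → count (entersStar σ c) ≤ suc r + suc r * r
  count-entersStar σ c =
    ≤-trans (length-filterᵇ-∨ _ _ (allFin n)) (+-mono-≤ (count-inStar σ c) (begin
      count (λ u → any (dart D u) (members (inStar σ c)))
        ≤⟨ length-filterᵇ-any (λ x u → dart D u x) (members (inStar σ c)) (allFin n)
                              (≤-reflexive ∘ proj₂ ∘ reg) ⟩
      count (inStar σ c) * r
        ≤⟨ *-monoˡ-≤ r (count-inStar σ c) ⟩
      suc r * r ∎))
    where open ≤-Reasoning

  -- The vertices z that the centre of a τ-star chosen after the σ-star at c must avoid.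
  near : Dir → Fin n → Dir → Fin n → Bool
  near σ c τ z = inStar σ c z ∨ (any (leaf τ z) (members (entersStar σ c))
                                 ∨ any (λ w → dart D w z) (members (leaf σ c)))

  count-near : ∀ σ c τ → count (near σ c τ) ≤ nearBound r
  count-near σ c τ = ≤-trans (length-filterᵇ-∨ _ _ (allFin n)) (+-mono-≤ (count-inStar σ c)
    (≤-trans (length-filterᵇ-∨ _ _ (allFin n)) (+-mono-≤ (begin
      count (λ z → any (leaf τ z) (members (entersStar σ c)))
        ≤⟨ length-filterᵇ-any (λ u z → leaf τ z u) (members (entersStar σ c)) (allFin n)
                              (≤-reflexive ∘ count-centres τ) ⟩
      count (entersStar σ c) * r
        ≤⟨ *-monoˡ-≤ r (count-entersStar σ c) ⟩
      (suc r + suc r * r) * r ∎) (begin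
      count (λ z → any (λ w → dart D w z) (members (leaf σ c)))
        ≤⟨ length-filterᵇ-any (dart D) (members (leaf σ c)) (allFin n) (≤-reflexive ∘ proj₁ ∘ reg) ⟩
      count (leaf σ c) * r
        ≡⟨ cong (_* r) (count-leaf σ c) ⟩
      r * r ∎))))
    where open ≤-Reasoning

  record Separated (σ : Dir) (c : Fin n) (τ : Dir) (z : Fin n) : Set where
    field
      centre∉ : ¬ T (inStar σ c z)
      leaf∉   : ∀ {u} → T (leaf τ z u) → ¬ T (inStar σ c u)
      leaf↛   : ∀ {u x} → T (leaf τ z u) → T (inStar σ c x) → ¬ Dart D u x
      ↛centre : ∀ {w} → T (leaf σ c w) → ¬ Dart D w z

    disjoint : ∀ {v} → T (inStar σ c v) → ¬ T (inStar τ z v)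
    disjoint v∈c v∈z with inStar⁻ τ v∈z
    ... | inj₁ refl = centre∉ v∈c
    ... | inj₂ v∈z′ = leaf∉ v∈z′ v∈c

  separated : ∀ {σ c τ z} → ¬ T (near σ c τ z) → Separated σ c τ z
  separated {σ} {c} {τ} {z} far = record
    { centre∉ = far ∘ T-∨ˡ
    ; leaf∉   = λ u∈z u∈c → far (near-leaf u∈z (T-∨ˡ u∈c))
    ; leaf↛   = λ u∈z x∈c d → far (near-leaf u∈z (enters-by-dart x∈c d))
    ; ↛centre = λ w∈c d → far (near-by-dart w∈c d)
    }
    where
    enters-by-dart : ∀ {u x} → T (inStar σ c x) → Dart D u x → T (entersStar σ c u)
    enters-by-dart {u} x∈c d =
      T-∨ʳ {a = inStar σ c u} (T-any (dart D u) (∈-members (inStar σ c) x∈c) d)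

    near-leaf : ∀ {u} → T (leaf τ z u) → T (entersStar σ c u) → T (near σ c τ z)
    near-leaf u∈z u→c = T-∨ʳ {a = inStar σ c z}
      (T-∨ˡ (T-any (leaf τ z) (∈-members (entersStar σ c) u→c) u∈z))

    near-by-dart : ∀ {w} → T (leaf σ c w) → Dart D w z → T (near σ c τ z)
    near-by-dart w∈c d = T-∨ʳ {a = inStar σ c z}
      (T-∨ʳ {a = any (leaf τ z) (members (entersStar σ c))}
        (T-any (λ w → dart D w z) (∈-members (leaf σ c) w∈c) d))

module StarIndex (r : ℕ) where

  Star : Set
  Star = Dir × Fin (suc r)

  dir : Star → Dir
  dir = proj₁

  colour : Star → Fin (suc r)
  colour = proj₂

  -- The order in which centres are chosen. In-stars come first, so that a dart from
  -- the out-centre of colour i to the in-centre of colour i is excluded by `near`.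
  ι : Star → ℕ
  ι (⊖ , i) = toℕ i
  ι (⊕ , i) = suc r + toℕ i

  ι≤ : ∀ a → ι a ≤ suc r + r
  ι≤ (⊖ , i) = ≤-trans (toℕ≤pred[n] i) (m≤n+m r (suc r))
  ι≤ (⊕ , i) = +-monoʳ-≤ (suc r) (toℕ≤pred[n] i)

  ι-injective : ∀ {a b} → ι a ≡ ι b → a ≡ b
  ι-injective {⊖ , i} {⊖ , j} e = cong (⊖ ,_) (toℕ-injective e)
  ι-injective {⊕ , i} {⊕ , j} e = cong (⊕ ,_) (toℕ-injective (+-cancelˡ-≡ (suc r) _ _ e))
  ι-injective {⊖ , i} {⊕ , j} e =
    contradiction (subst (_< suc r) e (toℕ<n i)) (m+n≮m (suc r) (toℕ j))
  ι-injective {⊕ , i} {⊖ , j} e =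
    contradiction (subst (_< suc r) (sym e) (toℕ<n j)) (m+n≮m (suc r) (toℕ i))

  dirAt : ℕ → Dir
  dirAt t with t <? suc r
  ... | yes _ = ⊖
  ... | no _  = ⊕

  dirAt-ι : ∀ a → dirAt (ι a) ≡ dir a
  dirAt-ι (⊖ , i) with toℕ i <? suc r
  ... | yes _ = refl
  ... | no i≮ = contradiction (toℕ<n i) i≮
  dirAt-ι (⊕ , i) with suc r + toℕ i <? suc r
  ... | yes r+i< = contradiction r+i< (m+n≮m (suc r) (toℕ i))
  ... | no _     = refl

  ∃Star? : ∀ {P : Star → Set} → (∀ a → Dec (P a)) → Dec (∃ P)
  ∃Star? P? with any? (λ i → P? (⊕ , i)) | any? (λ i → P? (⊖ , i))
  ... | yes (i , p) | _           = yes ((⊕ , i) , p)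
  ... | no _        | yes (i , p) = yes ((⊖ , i) , p)
  ... | no ¬⊕       | no ¬⊖       =
    no λ { ((⊕ , i) , p) → ¬⊕ (i , p) ; ((⊖ , i) , p) → ¬⊖ (i , p) }

module _ (D : Digraph n) {r} (reg : Regular r D) where
  open Stars D reg
  open StarIndex r

  SpreadCentres : (ℕ → Fin n) → Set
  SpreadCentres x =
    ∀ {s t} → s < t → t ≤ suc r + r → ¬ T (near (dirAt s) (x s) (dirAt t) (x t))

  spread-centres : (suc r + r) * nearBound r < n → Σ (ℕ → Fin n) SpreadCentres
  spread-centres =
    spread (λ s c t → near (dirAt s) c (dirAt t)) (λ s c t → count-near (dirAt s) c (dirAt t))

module Colouring (D : Digraph n) {r} (reg : Regular r D)
                 (x : ℕ → Fin n) (spread-out : SpreadCentres D reg x) where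
  open Stars D reg
  open StarIndex r

  centre : Star → Fin n
  centre a = x (ι a)

  separation : ∀ a b → ι a < ι b → Separated (dir a) (centre a) (dir b) (centre b)
  separation a b a<b = separated (subst₂ (λ σ τ → ¬ T (near σ (centre a) τ (centre b)))
    (dirAt-ι a) (dirAt-ι b) (spread-out a<b (ι≤ b)))

  memberOf : Star → Fin n → Bool
  memberOf a = inStar (dir a) (centre a)

  leafOf : Star → Fin n → Bool
  leafOf a = leaf (dir a) (centre a)

  stars-disjoint : ∀ {a b v} → T (memberOf a v) → T (memberOf b v) → a ≡ b
  stars-disjoint {a} {b} v∈a v∈b with <-cmp (ι a) (ι b)
  ... | tri< a<b _ _ = contradiction v∈b (Separated.disjoint (separation a b a<b) v∈a)
  ... | tri≈ _ a≡b _ = ι-injective a≡b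
  ... | tri> _ _ b<a = contradiction v∈a (Separated.disjoint (separation b a b<a) v∈b)

  leafAt : Star → Fin r → Fin n
  leafAt a = proj₁ (enumerate (leafOf a) (count-leaf (dir a) (centre a)))

  leafAt-injective : ∀ a → Injective _≡_ _≡_ (leafAt a)
  leafAt-injective a = proj₁ (proj₂ (enumerate (leafOf a) (count-leaf (dir a) (centre a))))

  leafAt-leaf : ∀ a q → T (leafOf a (leafAt a q))
  leafAt-leaf a = proj₂ (proj₂ (enumerate (leafOf a) (count-leaf (dir a) (centre a))))

  centre≢leafAt : ∀ a q → centre a ≢ leafAt a q
  centre≢leafAt a q e =
    leaf-irreflexive (dir a) (subst (T ∘ leafOf a) (sym e) (leafAt-leaf a q))

  -- The vertex of star a that receives colour j: the centre receives colour a,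
  -- and the leaves receive the r other colours.
  slot : Star → Fin (suc r) → Fin n
  slot a j with colour a ≟ j
  ... | yes _  = centre a
  ... | no a≢j = leafAt a (punchOut a≢j)

  slot-centre : ∀ a → slot a (colour a) ≡ centre a
  slot-centre a with colour a ≟ colour a
  ... | yes _  = refl
  ... | no a≢a = contradiction refl a≢a

  slot-leaf : ∀ a {j} → colour a ≢ j → T (leafOf a (slot a j))
  slot-leaf a {j} a≢j with colour a ≟ j
  ... | yes a≡j = contradiction a≡j a≢j
  ... | no _    = leafAt-leaf a _

  slot-member : ∀ a j → T (memberOf a (slot a j))
  slot-member a j with colour a ≟ j
  ... | yes _ = inStar-centre (dir a) (centre a)
  ... | no _  = inStar-leaf (dir a) (leafAt-leaf a _)

  slot-injectiveʳ : ∀ a {j j′} → slot a j ≡ slot a j′ → j ≡ j′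
  slot-injectiveʳ a {j} {j′} e with colour a ≟ j | colour a ≟ j′
  ... | yes a≡j | yes a≡j′ = trans (sym a≡j) a≡j′
  ... | yes _   | no _     = contradiction e (centre≢leafAt a _)
  ... | no _    | yes _    = contradiction (sym e) (centre≢leafAt a _)
  ... | no a≢j  | no a≢j′  = punchOut-injective a≢j a≢j′ (leafAt-injective a e)

  slot-injective : ∀ {a j b j′} → slot a j ≡ slot b j′ → (a , j) ≡ (b , j′)
  slot-injective {a} {j} {b} {j′} e
    with refl ← stars-disjoint {a} {b} (slot-member a j)
                  (subst (T ∘ memberOf b) (sym e) (slot-member b j′))
    = cong (a ,_) (slot-injectiveʳ a e)

  starCount : ℕ
  starCount = suc (suc r + r)

  slotRank : Star → Fin (suc r) → ℕ
  slotRank a j with colour a ≟ j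
  ... | yes _ = ι a
  ... | no _  = starCount + ι a

  slotRank< : ∀ a j → slotRank a j < starCount + starCount
  slotRank< a j with colour a ≟ j
  ... | yes _ = <-≤-trans (s≤s (ι≤ a)) (m≤m+n starCount starCount)
  ... | no _  = +-monoʳ-< starCount (s≤s (ι≤ a))

  centre-before-leaf : ∀ a b → ι a < starCount + ι b
  centre-before-leaf a b = <-≤-trans (s≤s (ι≤ a)) (m≤m+n starCount (ι b))

  same-colour-backwards : ∀ a b → ι b < ι a → colour a ≡ colour b →
                          Dart D (centre a) (centre b) → T (leafOf b (centre a))
  same-colour-backwards (⊕ , i) (⊖ , .i) _   refl d = d
  same-colour-backwards (⊖ , i) (⊖ , .i) b<a refl _ = contradiction b<a (<-irrefl refl)
  same-colour-backwards (⊕ , i) (⊕ , .i) b<a refl _ = contradiction b<a (<-irrefl refl)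
  same-colour-backwards (⊖ , i) (⊕ , .i) b<a refl _ =
    contradiction b<a (m+n≮n (suc r) (toℕ i))

  slotRank-forwards : ∀ {a b j} → ι a < ι b →
                      Dart D (slot a j) (slot b j) → slotRank a j < slotRank b j
  slotRank-forwards {a} {b} {j} a<b d with colour a ≟ j | colour b ≟ j
  ... | yes _ | yes _ = a<b
  ... | yes _ | no _  = centre-before-leaf a b
  ... | no _  | yes _ = contradiction d (Separated.↛centre (separation a b a<b) (leafAt-leaf a _))
  ... | no _  | no _  = +-monoʳ-< starCount a<b

  slotRank-backwards : ∀ {a b j} → ι b < ι a →
                       Dart D (slot a j) (slot b j) → slotRank a j < slotRank b j
  slotRank-backwards {a} {b} {j} b<a d with colour a ≟ j | colour b ≟ j
  ... | yes a≡j | yes b≡j = contradiction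
    (inStar-leaf (dir b) (same-colour-backwards a b b<a (trans a≡j (sym b≡j)) d))
    (Separated.centre∉ (separation b a b<a))
  ... | yes _ | no _  = centre-before-leaf a b
  ... | no _  | yes _ = contradiction d
    (Separated.leaf↛ (separation b a b<a) (leafAt-leaf a _) (inStar-centre (dir b) (centre b)))
  ... | no _  | no _  = contradiction d
    (Separated.leaf↛ (separation b a b<a) (leafAt-leaf a _) (inStar-leaf (dir b) (leafAt-leaf b _)))

  slotRank-increasing : ∀ {a b j} → Dart D (slot a j) (slot b j) → slotRank a j < slotRank b j
  slotRank-increasing {a} {b} {j} d with <-cmp (ι a) (ι b)
  ... | tri< a<b _ _ = slotRank-forwards {a} {b} {j} a<b d
  ... | tri≈ _ a≡b _ =
    contradiction (cong (λ a → slot a j) (ι-injective {a} {b} a≡b)) (Dart-irreflexive D d)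
  ... | tri> _ _ b<a = slotRank-backwards {a} {b} {j} b<a d

  slot? : ∀ v → Dec (∃₂ λ a j → slot a j ≡ v)
  slot? v = ∃Star? λ a → any? λ j → slot a j ≟ v

  isSlot : Fin n → Bool
  isSlot v = ⌊ slot? v ⌋

  -- Off the slots the values are irrelevant: ranked-extension only reads them on isSlot.
  precolour : Fin n → Fin (suc r)
  precolour v with slot? v
  ... | yes (_ , j , _) = j
  ... | no _            = zero

  precolourRank : Fin n → ℕ
  precolourRank v with slot? v
  ... | yes (a , j , _) = slotRank a j
  ... | no _            = zero

  precolour-slot : ∀ a j → precolour (slot a j) ≡ j
  precolour-slot a j with slot? (slot a j)
  ... | yes (b , j′ , e) = cong proj₂ (slot-injective {b} {j′} {a} {j} e)
  ... | no ¬slot         = contradiction (a , j , refl) ¬slot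

  precolourRank-slot : ∀ a j → precolourRank (slot a j) ≡ slotRank a j
  precolourRank-slot a j with slot? (slot a j)
  ... | yes (b , j′ , e) with refl ← slot-injective {b} {j′} {a} {j} e = refl
  ... | no ¬slot         = contradiction (a , j , refl) ¬slot

  precolourRank-bounded : ∀ {v} → T (isSlot v) → precolourRank v < starCount + starCount
  precolourRank-bounded s with a , j , refl ← toWitness s =
    subst (_< starCount + starCount) (sym (precolourRank-slot a j)) (slotRank< a j)

  precolourRank-increasing : ∀ {u w} → Dart D u w → T (isSlot u) → T (isSlot w) →
                             precolour u ≡ precolour w → precolourRank u < precolourRank w
  precolourRank-increasing d su sw e
    with a , j , refl ← toWitness su | b , j′ , refl ← toWitness sw
    with refl ← trans (sym (precolour-slot a j)) (trans e (precolour-slot b j′))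
    = subst₂ _<_ (sym (precolourRank-slot a j)) (sym (precolourRank-slot b j))
                 (slotRank-increasing {a} {b} {j} d)

  extension : Σ (Fin n → Fin (suc r)) λ c → Agrees isSlot precolour c × Ranked D c
  extension = ranked-extension D (λ u → s≤s (≤-reflexive (proj₁ (reg u))))
    isSlot precolour precolourRank (starCount + starCount)
    precolourRank-bounded precolourRank-increasing

  colouring : Fin n → Fin (suc r)
  colouring = proj₁ extension

  colouring-slot : ∀ a j → colouring (slot a j) ≡ j
  colouring-slot a j =
    trans (proj₁ (proj₂ extension) (fromWitness (a , j , refl))) (precolour-slot a j)

  colouring-centre : ∀ a → colouring (centre a) ≡ colour a
  colouring-centre a =
    subst (λ v → colouring v ≡ colour a) (slot-centre a) (colouring-slot a (colour a))

  leaves-see-all-colours : ∀ a j → j ≢ colouring (centre a) →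
                           ∃ λ w → T (leafOf a w) × colouring w ≡ j
  leaves-see-all-colours a j j≢a = slot a j ,
    slot-leaf a (λ a≡j → j≢a (trans (sym a≡j) (sym (colouring-centre a)))) , colouring-slot a j

  acyclic-b-colouring : HasAcyclicB D (suc r)
  acyclic-b-colouring = ς , ranked⇒acyclic D ς (proj₂ (proj₂ extension)) , λ i →
      (centre (⊕ , i) , colouring-centre (⊕ , i) , leaves-see-all-colours (⊕ , i))
    , (centre (⊖ , i) , colouring-centre (⊖ , i) , leaves-see-all-colours (⊖ , i))
    where
    ς : Coloring (suc r)
    ς = record { col = colouring ; surj = λ j → slot (⊕ , j) j , colouring-slot (⊕ , j) j }

-- 8 r ^ 4 − (2r + 1) · nearBound r as a polynomial in s = r − 2 with nonnegative
-- coefficients; r ^ 4 is unfolded because the ring solver does not handle _^_.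
budget-identity : ∀ s → let r = 2 + s in
  8 * (r * (r * (r * (r * 1))))
    ≡ (1 + r + r) * (1 + r + ((1 + r + (1 + r) * r) * r + r * r))
      + (1 + (6 * s * s * s * s + 41 * s * s * s + 95 * s * s + 76 * s + 2))
budget-identity = solve-∀

spread-budget : ∀ {r} → 2 ≤ r → (suc r + r) * nearBound r < 8 * r ^ 4
spread-budget {suc (suc s)} (s≤s (s≤s z≤n)) =
  <-≤-trans (m<m+n _ (s≤s z≤n)) (≤-reflexive (sym (budget-identity s)))

theorem15 : ∀ (r n : ℕ) (D : Digraph n) → 2 ≤ r → 8 * r ^ 4 ≤ n →
    Regular r D → DibEq D (r + 1)
theorem15 r n D 2≤r large reg rewrite +-comm r 1 =
    let x , spread-out = spread-centres D reg (<-≤-trans (spread-budget 2≤r) large)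
    in Colouring.acyclic-b-colouring D reg x spread-out
  , λ k (ς , _ , b) → b-colouring-bound D ς b (≤-reflexive ∘ proj₁ ∘ reg)
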